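{- Let $p>2$ be a prime and let $M_p$ be a linearly ordered set with $p$ elements, made into a monoid under the meet (minimum) operation. Then $M_p$ is an idempotent commutative monoid which is not isomorphic to the sandpile monoid $\mathcal{M}(\widehat{X})$ of any sandpile graph $\widehat{X}$.
   Context: A sandpile graph $\widehat{X}$ is a finite weakly connected directed multigraph (loops and multiple edges allowed) with a distinguished vertex, the sink, reachable by a directed path from every vertex; the set of non-sink vertices is nonempty. A configuration assigns a nonnegative integer number of grains to each non-sink vertex; it is stable if every $v$ holds fewer than $\deg^{+}(v)$ (out-degree) grains. Toppling an unstable vertex sends one grain along each of its out-edges (grains at the sink vanish; the sink never topples); every configuration has a unique stabilization. The sandpile monoid $\mathcal{M}(\widehat X)$ is the set of stable configurations with $a\oplus b$ = stabilization of the pointwise sum $a+b$. -}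

module Defs where

open import Data.Nat using (ℕ; zero; suc; _+_; _∸_; _≤_; _<_; _≤ᵇ_)
open import Data.Fin using (Fin; zero; suc; toℕ; _≟_)
open import Data.List using (List; map; allFin)
open import Data.Nat.ListAction using (sum)
open import Data.Vec using (Vec; lookup; tabulate)
open import Data.Bool using (if_then_else_)
open import Data.Product using (Σ; Σ-syntax; _×_; ∃-syntax)
open import Data.Sum using (_⊎_)
open import Relation.Nullary using (does)
open import Relation.Binary.PropositionalEquality using (_≡_)
open import Relation.Binary.Construct.Closure.ReflexiveTransitive using (Star)

_⊓ᶠ_ : {p : ℕ} → Fin p → Fin p → Fin p
x ⊓ᶠ y = if toℕ x ≤ᵇ toℕ y then x else y

-- Vertices : Fin (suc N); the sink is  zero , the non-sink vertices are
-- suc i  for  i : Fin N.  A directed multigraph (loops and multiple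
-- edges allowed) is given by its edge multiplicities  edges u w  =
-- number of edges from u to w.

record SandpileGraph : Set where
  field
    N        : ℕ
    nonempty : 1 ≤ N
    edges    : Fin (suc N) → Fin (suc N) → ℕ
    weaklyConnected : ∀ u v →
      Star (λ a b → (0 < edges a b) ⊎ (0 < edges b a)) u v
    sinkReachable : ∀ v → Star (λ a b → 0 < edges a b) v zero

module _ (G : SandpileGraph) where
  open SandpileGraph G

  -- out-degree of a non-sink vertex (all out-edges, incl. loops and
  -- edges into the sink)
  outdeg : Fin N → ℕ
  outdeg i = sum (map (edges (suc i)) (allFin (suc N)))

  Config : Set
  Config = Vec ℕ N

  Stable : Config → Set
  Stable c = ∀ i → lookup c i < outdeg i

  -- toppling vertex i: it loses outdeg i grains, each non-sink vertex j
  -- gains one grain per edge i → j (grains sent to the sink vanish).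
  fire : Config → Fin N → Config
  fire c i = tabulate λ j →
    (lookup c j + edges (suc i) (suc j)) ∸ (if does (j ≟ i) then outdeg i else 0)

  Topple : Config → Config → Set
  Topple c c' = Σ[ i ∈ Fin N ] (outdeg i ≤ lookup c i × c' ≡ fire c i)

  -- d is the stabilization of c: d is stable and reached from c by a
  -- finite sequence of legal topplings (unique, by the abelian property)
  Stabilizes : Config → Config → Set
  Stabilizes c d = Star Topple c d × Stable d

  _+ᶜ_ : Config → Config → Config
  a +ᶜ b = tabulate λ j → lookup a j + lookup b j

  -- the sandpile monoid M(G) consists of the stable configurations with
  -- a ⊕ b = stabilization of a + b.
  IsoToSandpileMonoid : (p : ℕ) → (Fin p → Config) → Set
  IsoToSandpileMonoid p φ =
    (∀ x → Stable (φ x)) ×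
    (∀ x y → φ x ≡ φ y → x ≡ y) ×
    (∀ c → Stable c → ∃[ x ] φ x ≡ c) ×
    (∀ x y → Stabilizes (φ x +ᶜ φ y) (φ (x ⊓ᶠ y)))

module Submission where

open import Defs
open import Data.Nat using (ℕ; _<_)
open import Data.Nat.Primality using (Prime)
open import Data.Fin using (Fin)
open import Data.Product using (Σ; Σ-syntax; _×_)
open import Relation.Nullary using (¬_)
open import Relation.Binary.PropositionalEquality using (_≡_)
open import Algebra.Structures using (IsIdempotentCommutativeMonoid)

open import Algebra.Construct.NaturalChoice.Base using (MinOperator)
import Algebra.Construct.NaturalChoice.MinOp as MinOp
open import Data.Bool using (true; false)
open import Data.Empty using (⊥-elim)
open import Data.Fin using (zero; suc; toℕ; fromℕ; _≟_)
import Data.Fin.Properties as Finₚ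
open import Data.Nat using (zero; suc; _+_; _∸_; _≤_; _≤ᵇ_; z≤n; s≤s)
import Data.Nat.Properties as ℕₚ
open import Data.Product using (_,_; proj₁; proj₂; ∃-syntax)
open import Data.Sum using (_⊎_; inj₁; inj₂)
open import Data.Vec using (Vec; []; _∷_; lookup; tabulate; replicate; _[_]≔_)
open import Data.Vec.Properties using (lookup∘tabulate; lookup-replicate; lookup∘update; lookup∘update′)
open import Data.Vec.Relation.Binary.Pointwise.Extensional using (ext; Pointwise-≡⇒≡)
open import Relation.Binary.Bundles using (TotalOrder)
open import Relation.Binary.Construct.Closure.ReflexiveTransitive using (Star; ε; _◅_)
open import Relation.Binary.PropositionalEquality using (refl; sym; trans; cong; subst; _≢_; module ≡-Reasoning)
open import Relation.Nullary using (yes; no)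

-- In a chain under meet, x ∧ y is always x or y.  In a sandpile monoid, if a,
-- b and a + b are stable then a ⊕ b = a + b, so an isomorphism with a chain
-- forces a = 0 or b = 0 whenever a + b is stable.  Stability is a pointwise
-- upper bound, so it is inherited by smaller configurations and by sums of
-- configurations with disjoint supports.  Hence a nonzero stable configuration
-- is a single grain δᵢ, all such grains sit on one common vertex i, and the
-- monoid has at most the two elements 0 and δᵢ; a chain with p > 2 has more.

⊓ᶠ-minOperator : (p : ℕ) → MinOperator (TotalOrder.totalPreorder (Finₚ.≤-totalOrder p))
⊓ᶠ-minOperator p = record
  { _⊓_       = _⊓ᶠ_
  ; x≤y⇒x⊓y≈x = x≤y⇒x⊓ᶠy≡x
  ; x≥y⇒x⊓y≈y = x≥y⇒x⊓ᶠy≡y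
  }
  where
  x≤y⇒x⊓ᶠy≡x : ∀ {x y : Fin p} → toℕ x ≤ toℕ y → x ⊓ᶠ y ≡ x
  x≤y⇒x⊓ᶠy≡x {x} {y} x≤y with toℕ x ≤ᵇ toℕ y | ℕₚ.≤⇒≤ᵇ x≤y
  ... | true | _ = refl

  x≥y⇒x⊓ᶠy≡y : ∀ {x y : Fin p} → toℕ y ≤ toℕ x → x ⊓ᶠ y ≡ y
  x≥y⇒x⊓ᶠy≡y {x} {y} y≤x with toℕ x ≤ᵇ toℕ y | ℕₚ.≤ᵇ⇒≤ (toℕ x) (toℕ y)
  ... | true  | x≤y = Finₚ.≤-antisym (x≤y _) y≤x
  ... | false | _   = refl

⊓ᶠ-isIdempotentCommutativeMonoid : (n : ℕ) →
  IsIdempotentCommutativeMonoid _≡_ _⊓ᶠ_ (fromℕ n)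
⊓ᶠ-isIdempotentCommutativeMonoid n = record
  { isCommutativeMonoid = record
    { isMonoid = ⊓-isMonoid Finₚ.≤fromℕ
    ; comm     = ⊓-comm
    }
  ; idem = ⊓-idem
  }
  where open MinOp (⊓ᶠ-minOperator (suc n))

0ᶜ : ∀ {n} → Vec ℕ n
0ᶜ = replicate _ 0

δ : ∀ {n} → Fin n → Vec ℕ n
δ i = 0ᶜ [ i ]≔ 1

lookup-δ-≢ : ∀ {n} {i k : Fin n} → k ≢ i → lookup (δ i) k ≡ 0
lookup-δ-≢ {k = k} k≢i = trans (lookup∘update′ k≢i 0ᶜ 1) (lookup-replicate k 0)

δ≤positive : ∀ {n} {a : Vec ℕ n} {i} → 0 < lookup a i → ∀ k → lookup (δ i) k ≤ lookup a k
δ≤positive {a = a} {i} a>0 k with k ≟ i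
... | yes refl = subst (_≤ lookup a i) (sym (lookup∘update i 0ᶜ 1)) a>0
... | no k≢i   = subst (_≤ lookup a k) (sym (lookup-δ-≢ k≢i)) z≤n

δ≢0ᶜ : ∀ {n} (i : Fin n) → δ i ≢ 0ᶜ
δ≢0ᶜ i δi≡0 = ℕₚ.1+n≢0 (trans (sym (lookup∘update i 0ᶜ 1))
                                (trans (cong (λ c → lookup c i) δi≡0) (lookup-replicate i 0)))

≡0ᶜ⊎positive : ∀ {n} (a : Vec ℕ n) → a ≡ 0ᶜ ⊎ ∃[ i ] 0 < lookup a i
≡0ᶜ⊎positive []          = inj₁ refl
≡0ᶜ⊎positive (suc _ ∷ a) = inj₂ (zero , s≤s z≤n)
≡0ᶜ⊎positive (zero ∷ a) with ≡0ᶜ⊎positive a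
... | inj₁ refl      = inj₁ refl
... | inj₂ (i , a>0) = inj₂ (suc i , a>0)

module _ (G : SandpileGraph) where
  private
    _⊞_ : Config G → Config G → Config G
    _⊞_ = _+ᶜ_ G

  config-ext : ∀ {a b : Config G} → (∀ k → lookup a k ≡ lookup b k) → a ≡ b
  config-ext a≗b = Pointwise-≡⇒≡ (ext a≗b)

  lookup-+ᶜ : ∀ (a b : Config G) k → lookup (a ⊞ b) k ≡ lookup a k + lookup b k
  lookup-+ᶜ a b k = lookup∘tabulate _ k

  +ᶜ-identityʳ : ∀ (a : Config G) → a ⊞ 0ᶜ ≡ a
  +ᶜ-identityʳ a = config-ext λ k → begin
    lookup (a ⊞ 0ᶜ) k          ≡⟨ lookup-+ᶜ a 0ᶜ k ⟩
    lookup a k + lookup 0ᶜ k   ≡⟨ cong (lookup a k +_) (lookup-replicate k 0) ⟩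
    lookup a k + 0             ≡⟨ ℕₚ.+-identityʳ _ ⟩
    lookup a k                 ∎
    where open ≡-Reasoning

  +ᶜ-comm : ∀ (a b : Config G) → a ⊞ b ≡ b ⊞ a
  +ᶜ-comm a b = config-ext λ k → begin
    lookup (a ⊞ b) k          ≡⟨ lookup-+ᶜ a b k ⟩
    lookup a k + lookup b k   ≡⟨ ℕₚ.+-comm (lookup a k) _ ⟩
    lookup b k + lookup a k   ≡⟨ lookup-+ᶜ b a k ⟨
    lookup (b ⊞ a) k          ∎
    where open ≡-Reasoning

  +ᶜ-cancelˡ-≡ : ∀ (a : Config G) {b c} → a ⊞ b ≡ a ⊞ c → b ≡ c
  +ᶜ-cancelˡ-≡ a {b} {c} a+b≡a+c = config-ext λ k → ℕₚ.+-cancelˡ-≡ (lookup a k) _ _ (begin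
    lookup a k + lookup b k   ≡⟨ lookup-+ᶜ a b k ⟨
    lookup (a ⊞ b) k          ≡⟨ cong (λ d → lookup d k) a+b≡a+c ⟩
    lookup (a ⊞ c) k          ≡⟨ lookup-+ᶜ a c k ⟩
    lookup a k + lookup c k   ∎)
    where open ≡-Reasoning

  a+ᶜb≡a⇒b≡0ᶜ : ∀ {a b : Config G} → a ⊞ b ≡ a → b ≡ 0ᶜ
  a+ᶜb≡a⇒b≡0ᶜ {a} a+b≡a = +ᶜ-cancelˡ-≡ a (trans a+b≡a (sym (+ᶜ-identityʳ a)))

  a+ᶜb≡b⇒a≡0ᶜ : ∀ {a b : Config G} → a ⊞ b ≡ b → a ≡ 0ᶜ
  a+ᶜb≡b⇒a≡0ᶜ {a} {b} a+b≡b = a+ᶜb≡a⇒b≡0ᶜ (trans (+ᶜ-comm b a) a+b≡b)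

  _∸ᶜ_ : Config G → Config G → Config G
  a ∸ᶜ b = tabulate λ k → lookup a k ∸ lookup b k

  ∸ᶜ-≤ : ∀ (a b : Config G) k → lookup (a ∸ᶜ b) k ≤ lookup a k
  ∸ᶜ-≤ a b k = subst (_≤ lookup a k) (sym (lookup∘tabulate (λ k → lookup a k ∸ lookup b k) k))
                     (ℕₚ.m∸n≤m (lookup a k) (lookup b k))

  +ᶜ-∸ᶜ : ∀ (a b : Config G) → (∀ k → lookup b k ≤ lookup a k) → b ⊞ (a ∸ᶜ b) ≡ a
  +ᶜ-∸ᶜ a b b≤a = config-ext λ k → begin
    lookup (b ⊞ (a ∸ᶜ b)) k               ≡⟨ lookup-+ᶜ b (a ∸ᶜ b) k ⟩
    lookup b k + lookup (a ∸ᶜ b) k        ≡⟨ cong (lookup b k +_) (lookup∘tabulate _ k) ⟩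
    lookup b k + (lookup a k ∸ lookup b k) ≡⟨ ℕₚ.m+[n∸m]≡n (b≤a k) ⟩
    lookup a k                            ∎
    where open ≡-Reasoning

  δ+ᶜδ-below-either : ∀ {i j} → i ≢ j → ∀ k →
    lookup (δ i ⊞ δ j) k ≤ lookup (δ i) k ⊎ lookup (δ i ⊞ δ j) k ≤ lookup (δ j) k
  δ+ᶜδ-below-either {i} {j} i≢j k with k ≟ j
  ... | yes refl = inj₂ (ℕₚ.≤-reflexive
        (trans (lookup-+ᶜ (δ i) (δ j) k) (cong (_+ lookup (δ j) k) (lookup-δ-≢ (λ j≡i → i≢j (sym j≡i))))))
  ... | no k≢j   = inj₁ (ℕₚ.≤-reflexive
        (trans (lookup-+ᶜ (δ i) (δ j) k)
        (trans (cong (lookup (δ i) k +_) (lookup-δ-≢ k≢j)) (ℕₚ.+-identityʳ _))))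

  stable-below-either : ∀ (a b c : Config G) → Stable G a → Stable G b →
    (∀ k → lookup c k ≤ lookup a k ⊎ lookup c k ≤ lookup b k) → Stable G c
  stable-below-either a b c sa sb c≤a∨b k with c≤a∨b k
  ... | inj₁ c≤a = ℕₚ.≤-<-trans c≤a (sa k)
  ... | inj₂ c≤b = ℕₚ.≤-<-trans c≤b (sb k)

  stable-mono : ∀ (a c : Config G) → Stable G a → (∀ k → lookup c k ≤ lookup a k) → Stable G c
  stable-mono a c sa c≤a = stable-below-either a a c sa sa (λ k → inj₁ (c≤a k))

  stable-stabilizes-to-itself : ∀ {c d : Config G} → Stable G c → Star (Topple G) c d → c ≡ d
  stable-stabilizes-to-itself sc ε                          = refl
  stable-stabilizes-to-itself sc ((i , unstable , _) ◅ _) = ⊥-elim (ℕₚ.<⇒≱ (sc i) unstable)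

  StableSumsTrivial : Set
  StableSumsTrivial = ∀ a b → Stable G a → Stable G b → Stable G (a ⊞ b) → a ≡ 0ᶜ ⊎ b ≡ 0ᶜ

  module _ (trivial : StableSumsTrivial) where

    stable-above-δ⇒≡δ : ∀ a {i} → Stable G a → (∀ k → lookup (δ i) k ≤ lookup a k) → a ≡ δ i
    stable-above-δ⇒≡δ a {i} sa δi≤a
      with trivial (δ i) (a ∸ᶜ δ i) (stable-mono a (δ i) sa δi≤a)
                   (stable-mono a (a ∸ᶜ δ i) sa (∸ᶜ-≤ a (δ i)))
                   (subst (Stable G) (sym (+ᶜ-∸ᶜ a (δ i) δi≤a)) sa)
    ... | inj₁ δ≡0    = ⊥-elim (δ≢0ᶜ i δ≡0)
    ... | inj₂ rest≡0 = begin
      a                    ≡⟨ +ᶜ-∸ᶜ a (δ i) δi≤a ⟨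
      δ i ⊞ (a ∸ᶜ δ i)     ≡⟨ cong (δ i ⊞_) rest≡0 ⟩
      δ i ⊞ 0ᶜ             ≡⟨ +ᶜ-identityʳ (δ i) ⟩
      δ i                  ∎
      where open ≡-Reasoning

    positive-stable≡δ : ∀ a {i} → Stable G a → 0 < lookup a i → a ≡ δ i
    positive-stable≡δ a sa a>0 = stable-above-δ⇒≡δ a sa (δ≤positive {a = a} a>0)

    stable-δ-unique : ∀ {i j} → Stable G (δ i) → Stable G (δ j) → i ≡ j
    stable-δ-unique {i} {j} si sj with i ≟ j
    ... | yes i≡j = i≡j
    ... | no i≢j
      with trivial (δ i) (δ j) si sj
                   (stable-below-either (δ i) (δ j) (δ i ⊞ δ j) si sj (δ+ᶜδ-below-either i≢j))
    ...   | inj₁ δi≡0 = ⊥-elim (δ≢0ᶜ i δi≡0)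
    ...   | inj₂ δj≡0 = ⊥-elim (δ≢0ᶜ j δj≡0)

    positive-stable-unique : ∀ a b {i j} → Stable G a → Stable G b →
      0 < lookup a i → 0 < lookup b j → a ≡ b
    positive-stable-unique a b {i} {j} sa sb a>0 b>0 =
      trans a≡δi (trans (cong δ i≡j) (sym b≡δj))
      where
      a≡δi : a ≡ δ i
      a≡δi = positive-stable≡δ a sa a>0
      b≡δj : b ≡ δ j
      b≡δj = positive-stable≡δ b sb b>0
      i≡j : i ≡ j
      i≡j = stable-δ-unique (subst (Stable G) a≡δi sa) (subst (Stable G) b≡δj sb)

    at-most-two-stable : ∀ a b c → Stable G a → Stable G b → Stable G c →
      a ≡ b ⊎ a ≡ c ⊎ b ≡ c
    at-most-two-stable a b c sa sb sc
      with ≡0ᶜ⊎positive a | ≡0ᶜ⊎positive b | ≡0ᶜ⊎positive c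
    ... | inj₁ a≡0       | inj₁ b≡0       | _              = inj₁ (trans a≡0 (sym b≡0))
    ... | inj₁ a≡0       | inj₂ _         | inj₁ c≡0       = inj₂ (inj₁ (trans a≡0 (sym c≡0)))
    ... | inj₁ _         | inj₂ (_ , b>0) | inj₂ (_ , c>0) = inj₂ (inj₂ (positive-stable-unique b c sb sc b>0 c>0))
    ... | inj₂ _         | inj₁ b≡0       | inj₁ c≡0       = inj₂ (inj₂ (trans b≡0 (sym c≡0)))
    ... | inj₂ (_ , a>0) | inj₁ _         | inj₂ (_ , c>0) = inj₂ (inj₁ (positive-stable-unique a c sa sc a>0 c>0))
    ... | inj₂ (_ , a>0) | inj₂ (_ , b>0) | _              = inj₁ (positive-stable-unique a b sa sb a>0 b>0)

  module _ {p : ℕ} {φ : Fin p → Config G} (iso : IsoToSandpileMonoid G p φ) where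
    open MinOp (⊓ᶠ-minOperator p) using (⊓-sel)

    φ-stable : ∀ x → Stable G (φ x)
    φ-stable = proj₁ iso

    φ-injective : ∀ x y → φ x ≡ φ y → x ≡ y
    φ-injective = proj₁ (proj₂ iso)

    φ-onto : ∀ c → Stable G c → ∃[ x ] φ x ≡ c
    φ-onto = proj₁ (proj₂ (proj₂ iso))

    φ-homomorphic : ∀ x y → Stabilizes G (φ x ⊞ φ y) (φ (x ⊓ᶠ y))
    φ-homomorphic = proj₂ (proj₂ (proj₂ iso))

    stable-sum≡meet : ∀ x y → Stable G (φ x ⊞ φ y) → φ x ⊞ φ y ≡ φ (x ⊓ᶠ y)
    stable-sum≡meet x y s = stable-stabilizes-to-itself s (proj₁ (φ-homomorphic x y))

    chainIso⇒stableSumsTrivial : StableSumsTrivial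
    chainIso⇒stableSumsTrivial a b sa sb sab with φ-onto a sa | φ-onto b sb
    ... | x , refl | y , refl with ⊓-sel x y
    ...   | inj₁ x⊓y≡x = inj₂ (a+ᶜb≡a⇒b≡0ᶜ (trans (stable-sum≡meet x y sab) (cong φ x⊓y≡x)))
    ...   | inj₂ x⊓y≡y = inj₁ (a+ᶜb≡b⇒a≡0ᶜ (trans (stable-sum≡meet x y sab) (cong φ x⊓y≡y)))

    chainIso⇒at-most-two : ∀ x y z → x ≡ y ⊎ x ≡ z ⊎ y ≡ z
    chainIso⇒at-most-two x y z
      with at-most-two-stable chainIso⇒stableSumsTrivial (φ x) (φ y) (φ z)
                              (φ-stable x) (φ-stable y) (φ-stable z)
    ... | inj₁ φx≡φy         = inj₁ (φ-injective x y φx≡φy)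
    ... | inj₂ (inj₁ φx≡φz) = inj₂ (inj₁ (φ-injective x z φx≡φz))
    ... | inj₂ (inj₂ φy≡φz) = inj₂ (inj₂ (φ-injective y z φy≡φz))

theorem5p1 : (p : ℕ) → Prime p → 2 < p →
    (Σ[ e ∈ Fin p ] IsIdempotentCommutativeMonoid (_≡_ {A = Fin p}) _⊓ᶠ_ e)
    × ¬ (Σ[ G ∈ SandpileGraph ] Σ[ φ ∈ (Fin p → Config G) ] IsoToSandpileMonoid G p φ)
theorem5p1 (suc (suc (suc q))) _ (s≤s (s≤s (s≤s _))) =
  (fromℕ (suc (suc q)) , ⊓ᶠ-isIdempotentCommutativeMonoid (suc (suc q))) , no-iso
  where
  no-iso : ¬ (Σ[ G ∈ SandpileGraph ] Σ[ φ ∈ _ ] IsoToSandpileMonoid G _ φ)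
  no-iso (G , φ , iso) with chainIso⇒at-most-two G iso zero (suc zero) (suc (suc zero))
  ... | inj₁ ()
  ... | inj₂ (inj₁ ())
  ... | inj₂ (inj₂ ())
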